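{- Let $g\ge4$ be even and let $m$ be an odd integer relatively prime to $g$. Suppose that (i) every proper divisor $d$ of $m$ is complete, and (ii) $o_g(m)>\min_{n}\Big\{2^n\Big\lceil \frac{m}{(g-1)g^n}\Big\rceil\Big\}$, the minimum taken over natural numbers $n$. Then $m$ is complete. If only condition (ii) holds, then $m$ is not primitive.
   Context: For an odd integer $m\ge1$, an extreme cycle for the digit set $\{0,m\}$ (with respect to the even integer $g\ge4$) is a finite set of distinct integers $\{x_0,\dots,x_{r-1}\}$ together with digits $l_0,\dots,l_{r-1}\in\{0,m\}$ such that $x_{j+1}=(x_j+l_j)/g$ for $0\le j\le r-2$ and $x_0=(x_{r-1}+l_{r-1})/g$. The cycle $\{0\}$ is the trivial extreme cycle. $m$ is complete if the only extreme cycle for $\{0,m\}$ is the trivial one, and incomplete otherwise. An odd number $m$ is primitive if it is incomplete and every proper divisor of $m$ is complete. $o_g(m)$ denotes the order of $g$ in $U(\mathbb{Z}_m)$; $\lceil x\rceil$ is the smallest integer $\ge x$. -}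

module Defs where

open import Data.Nat using (ℕ; zero; suc; _+_; _*_; _∸_; _^_; _≤_; _<_; _%_; _/_)
open import Data.Nat.DivMod using (m%n<n)
open import Data.Nat.Divisibility using (_∣_)
open import Data.Fin using (Fin; toℕ; fromℕ<)
open import Data.Integer using (ℤ; +_) renaming (_*_ to _*ℤ_; _+_ to _+ℤ_)
open import Data.Product using (_×_; Σ)
open import Data.Sum using (_⊎_)
open import Function.Definitions using (Injective)
open import Relation.Binary.PropositionalEquality using (_≡_; _≢_)
open import Relation.Nullary using (¬_)

cyc : ∀ {r} → Fin (suc r) → Fin (suc r)
cyc {r} j = fromℕ< (m%n<n (suc (toℕ j)) (suc r))

-- An extreme cycle of length r+1 for the digit set {0,m} w.r.t. base g:
-- distinct integers x_0..x_r with digits l_j ∈ {0,m} such that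
-- x_{j+1} = (x_j + l_j)/g (indices mod r+1), i.e. g * x_{j+1} = x_j + l_j.
record ExtremeCycle (g m : ℕ) (r : ℕ) : Set where
  field
    x        : Fin (suc r) → ℤ
    l        : Fin (suc r) → ℤ
    digit    : ∀ j → l j ≡ + 0 ⊎ l j ≡ + m
    distinct : Injective _≡_ _≡_ x
    step     : ∀ j → (+ g) *ℤ x (cyc j) ≡ x j +ℤ l j

Complete : ℕ → ℕ → Set
Complete g m = ∀ r (C : ExtremeCycle g m r) → ∀ j → ExtremeCycle.x C j ≡ + 0

Incomplete : ℕ → ℕ → Set
Incomplete g m = ¬ Complete g m

Primitive : ℕ → ℕ → Set
Primitive g m = Incomplete g m × (∀ d → d ∣ m → d ≢ m → Complete g d)

IsOrder : ℕ → ℕ → ℕ → Set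
IsOrder g m k = 1 ≤ k × m ∣ (g ^ k ∸ 1) × (∀ k' → 1 ≤ k' → m ∣ (g ^ k' ∸ 1) → k ≤ k')

-- ceiling division ⌈a/b⌉ (b = 0 gives 0; never used with b = 0)
ceilDiv : ℕ → ℕ → ℕ
ceilDiv a zero = 0
ceilDiv a (suc b) = (a + b) / suc b

bound : ℕ → ℕ → ℕ → ℕ
bound g m n = 2 ^ n * ceilDiv m ((g ∸ 1) * g ^ n)

-- The entries of an extreme cycle satisfy 0 ≤ x_j ≤ m/(g-1), and since g ∤ m, one zero entry
-- forces all entries to vanish. For a nonzero cycle let d = gcd(x₀, m). If d ≠ 1, every
-- entry is divisible by d and dividing by d gives a nonzero cycle for the proper divisor m/d.
-- If d = 1, going once around the cycle gives g^(r+1) x₀ ≡ x₀ (mod m), so the length r+1 is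
-- at least o_g(m), while a counting argument bounds it by 2^n ⌈m/((g-1)g^n)⌉ < o_g(m).
module Submission where

open import Defs
open import Data.Nat
  using (ℕ; zero; suc; _+_; _*_; _∸_; _^_; _/_; _%_; _≤_; _<_; z≤n; s≤s; z<s; pred;
         NonZero; >-nonZero; >-nonZero⁻¹; ≢-nonZero; ≢-nonZero⁻¹)
open import Data.Nat.Properties as ℕₚ using ()
open import Data.Nat.DivMod
  using (m<n⇒m%n≡m; [m+n]%n≡m%n; %-distribˡ-+; m%n%n≡m%n; m≡m%n+[m/n]*n; m%n<n;
         m/n*n≤m; m*n/n≡m; /-monoˡ-≤; m/n*n≡m; *-/-assoc; +-distrib-/-∣ˡ; 0/n≡0)
open import Data.Nat.Divisibility
  using (_∣_; divides; _∣0; ∣-refl; ∣-trans; ∣m∣n⇒∣m+n; ∣m+n∣m⇒∣n; ∣n⇒∣m*n; n∣m*n; m/n∣m)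
open import Data.Nat.Coprimality using (Coprime; coprime-divisor; gcd≡1⇒coprime) renaming (sym to coprime-sym)
open import Data.Nat.GCD using (gcd; gcd[m,n]∣m; gcd[m,n]∣n; gcd[m,n]≢0)
open import Data.Fin using (Fin; toℕ; fromℕ<; combine) renaming (zero to fzero; suc to fsuc)
open import Data.Fin.Properties using (toℕ-injective; toℕ-fromℕ<; toℕ<n; combine-injective; injective⇒≤)
open import Data.Integer as ℤ using (+_; -[1+_]; -≤-)
open import Data.Integer.Properties as ℤₚ using ()
open import Data.List using (allFin)
open import Data.List.Relation.Unary.All as All using ()
open import Data.List.Membership.Propositional.Properties using (∈-allFin)
open import Data.Product using (_×_; ∃; _,_; proj₁; proj₂)
open import Data.Sum as Sum using (_⊎_; inj₁; inj₂)
open import Data.Empty using (⊥; ⊥-elim)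
open import Function.Definitions using (Injective)
open import Relation.Binary.Bundles using (TotalOrder)
open import Algebra.Properties.CommutativeSemigroup ℕₚ.+-commutativeSemigroup
  using () renaming (xy∙z≈xz∙y to +-xy∙z≈xz∙y)
open import Algebra.Properties.CommutativeSemigroup ℕₚ.*-commutativeSemigroup
  using () renaming (x∙yz≈y∙xz to *-x∙yz≈y∙xz; x∙yz≈yx∙z to *-x∙yz≈yx∙z)
open import Relation.Nullary using (¬_; yes; no)
open import Relation.Nullary.Decidable using (decidable-stable)
open import Relation.Binary.PropositionalEquality
  using (_≡_; _≢_; refl; sym; trans; cong; cong₂; subst; module ≡-Reasoning)

<-ceilDiv : ∀ q m H → 0 < H → q * H < m → q < ceilDiv m H
<-ceilDiv q m (suc b) _ qH<m = begin
  suc q                   ≡⟨ m*n/n≡m (suc q) (suc b) ⟨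
  suc q * suc b / suc b   ≤⟨ /-monoˡ-≤ (suc b) (begin
    suc q * suc b           ≡⟨ ℕₚ.+-suc b (q * suc b) ⟨
    b + suc (q * suc b)     ≤⟨ ℕₚ.+-monoʳ-≤ b qH<m ⟩
    b + m                   ≡⟨ ℕₚ.+-comm b m ⟩
    m + b                   ∎) ⟩
  (m + b) / suc b         ∎
  where open ℕₚ.≤-Reasoning

∣∧<⇒≡0 : ∀ {G k} → G ∣ k → k < G → k ≡ 0
∣∧<⇒≡0 (divides zero    k≡0)  _   = k≡0
∣∧<⇒≡0 {G} (divides (suc q) k≡qG) k<G =
  ⊥-elim (ℕₚ.<-irrefl refl (ℕₚ.<-≤-trans k<G (subst (G ≤_) (sym k≡qG) (ℕₚ.m≤m+n G (q * G)))))

residue-unique-≤ : ∀ {G D u v} → u ≤ v → v < G → G ∣ u + D → G ∣ v + D → u ≡ v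
residue-unique-≤ {G} {D} {u} {v} u≤v v<G G∣u+D G∣v+D =
  ℕₚ.≤-antisym u≤v (ℕₚ.m∸n≡0⇒m≤n (∣∧<⇒≡0 G∣v∸u (ℕₚ.≤-<-trans (ℕₚ.m∸n≤m v u) v<G)))
  where
  v+D≡u+D+[v∸u] : v + D ≡ u + D + (v ∸ u)
  v+D≡u+D+[v∸u] = trans (cong (_+ D) (sym (ℕₚ.m+[n∸m]≡n u≤v))) (+-xy∙z≈xz∙y u (v ∸ u) D)
  G∣v∸u : G ∣ v ∸ u
  G∣v∸u = ∣m+n∣m⇒∣n (subst (G ∣_) v+D≡u+D+[v∸u] G∣v+D) G∣u+D

residue-unique : ∀ {G D u v} → u < G → v < G → G ∣ u + D → G ∣ v + D → u ≡ v
residue-unique {u = u} {v} u<G v<G G∣u+D G∣v+D with ℕₚ.≤-total u v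
... | inj₁ u≤v = residue-unique-≤ u≤v v<G G∣u+D G∣v+D
... | inj₂ v≤u = sym (residue-unique-≤ v≤u u<G G∣v+D G∣u+D)

∣+⇒∣%+ : ∀ {A D} G .{{_ : NonZero G}} → G ∣ A + D → G ∣ A % G + D
∣+⇒∣%+ {A} {D} G G∣A+D = ∣m+n∣m⇒∣n (subst (G ∣_) A+D≡[A/G]*G+[A%G+D] G∣A+D) (n∣m*n (A / G))
  where
  A+D≡[A/G]*G+[A%G+D] : A + D ≡ A / G * G + (A % G + D)
  A+D≡[A/G]*G+[A%G+D] = trans (cong (_+ D) (trans (m≡m%n+[m/n]*n A G) (ℕₚ.+-comm (A % G) _)))
                               (ℕₚ.+-assoc (A / G * G) (A % G) D)

≡-by-quotient : ∀ {A B D} G .{{_ : NonZero G}} → G ∣ A + D → G ∣ B + D → A / G ≡ B / G → A ≡ B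
≡-by-quotient {A} {B} G G∣A+D G∣B+D A/G≡B/G = begin
  A                    ≡⟨ m≡m%n+[m/n]*n A G ⟩
  A % G + A / G * G    ≡⟨ cong₂ (λ u q → u + q * G) residues A/G≡B/G ⟩
  B % G + B / G * G    ≡⟨ m≡m%n+[m/n]*n B G ⟨
  B                    ∎
  where
  open ≡-Reasoning
  residues : A % G ≡ B % G
  residues = residue-unique (m%n<n A G) (m%n<n B G) (∣+⇒∣%+ G G∣A+D) (∣+⇒∣%+ G G∣B+D)

cycⁿ : ∀ {r} → ℕ → Fin (suc r) → Fin (suc r)
cycⁿ zero    j = j
cycⁿ (suc t) j = cyc (cycⁿ t j)

[m+n%d]%d≡[m+n]%d : ∀ m n d .{{_ : NonZero d}} → (m + n % d) % d ≡ (m + n) % d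
[m+n%d]%d≡[m+n]%d m n d = begin
  (m + n % d) % d          ≡⟨ %-distribˡ-+ m (n % d) d ⟩
  (m % d + n % d % d) % d  ≡⟨ cong (λ k → (m % d + k) % d) (m%n%n≡m%n n d) ⟩
  (m % d + n % d) % d      ≡⟨ %-distribˡ-+ m n d ⟨
  (m + n) % d              ∎
  where open ≡-Reasoning

toℕ-cycⁿ : ∀ {r} t (j : Fin (suc r)) → toℕ (cycⁿ t j) ≡ (t + toℕ j) % suc r
toℕ-cycⁿ zero    j = sym (m<n⇒m%n≡m (toℕ<n j))
toℕ-cycⁿ {r} (suc t) j = begin
  toℕ (cyc (cycⁿ t j))               ≡⟨ toℕ-fromℕ< _ ⟩
  suc (toℕ (cycⁿ t j)) % suc r       ≡⟨ cong (λ i → suc i % suc r) (toℕ-cycⁿ t j) ⟩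
  (1 + (t + toℕ j) % suc r) % suc r  ≡⟨ [m+n%d]%d≡[m+n]%d 1 (t + toℕ j) (suc r) ⟩
  suc (t + toℕ j) % suc r            ∎
  where open ≡-Reasoning

cycⁿ-≡ : ∀ {r} t (k j : Fin (suc r)) → t + toℕ k ≡ toℕ j + suc r → cycⁿ t k ≡ j
cycⁿ-≡ {r} t k j e = toℕ-injective (begin
  toℕ (cycⁿ t k)           ≡⟨ toℕ-cycⁿ t k ⟩
  (t + toℕ k) % suc r      ≡⟨ cong (_% suc r) e ⟩
  (toℕ j + suc r) % suc r  ≡⟨ [m+n]%n≡m%n (toℕ j) (suc r) ⟩
  toℕ j % suc r            ≡⟨ m<n⇒m%n≡m (toℕ<n j) ⟩
  toℕ j                    ∎)
  where open ≡-Reasoning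

cycⁿ-reaches : ∀ {r} (k j : Fin (suc r)) → cycⁿ (toℕ j + (suc r ∸ toℕ k)) k ≡ j
cycⁿ-reaches {r} k j = cycⁿ-≡ _ k j (trans (ℕₚ.+-assoc (toℕ j) _ (toℕ k))
  (cong (λ n → toℕ j + n) (ℕₚ.m∸n+n≡m (ℕₚ.<⇒≤ (toℕ<n k)))))

cyc⁻¹ : ∀ {r} → Fin (suc r) → Fin (suc r)
cyc⁻¹ {r} = cycⁿ r

cyc-inverseʳ : ∀ {r} (j : Fin (suc r)) → cyc (cyc⁻¹ j) ≡ j
cyc-inverseʳ {r} j = cycⁿ-≡ (suc r) j j (ℕₚ.+-comm (suc r) (toℕ j))

module _ {r : ℕ} (P : Fin (suc r) → Set) (preserved : ∀ j → P j → P (cyc j)) where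

  cycⁿ-preserves : ∀ t {k} → P k → P (cycⁿ t k)
  cycⁿ-preserves zero    pk = pk
  cycⁿ-preserves (suc t) pk = preserved _ (cycⁿ-preserves t pk)

  cyc-invariant : ∀ {k} → P k → ∀ j → P j
  cyc-invariant {k} pk j = subst P (cycⁿ-reaches k j) (cycⁿ-preserves (toℕ j + (suc r ∸ toℕ k)) pk)

module _ {b ℓ₁ ℓ₂} (O : TotalOrder b ℓ₁ ℓ₂) where
  open TotalOrder O using (Carrier) renaming (_≤_ to _≼_)
  open import Data.List.Extrema O using (argmin; argmax; f[argmin]≤f[xs]; f[xs]≤f[argmax])

  minimiser : ∀ {n} (f : Fin (suc n) → Carrier) → ∃ λ i → ∀ j → f i ≼ f j
  minimiser {n} f = argmin f fzero (allFin (suc n))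
                  , λ j → All.lookup (f[argmin]≤f[xs] {f = f} fzero (allFin (suc n))) (∈-allFin j)

  maximiser : ∀ {n} (f : Fin (suc n) → Carrier) → ∃ λ i → ∀ j → f j ≼ f i
  maximiser {n} f = argmax f fzero (allFin (suc n))
                  , λ j → All.lookup (f[xs]≤f[argmax] {f = f} fzero (allFin (suc n))) (∈-allFin j)

record NatExtremeCycle (g m r : ℕ) : Set where
  field
    x        : Fin (suc r) → ℕ
    l        : Fin (suc r) → ℕ
    digit    : ∀ j → l j ≡ 0 ⊎ l j ≡ m
    distinct : Injective _≡_ _≡_ x
    step     : ∀ j → g * x (cyc j) ≡ x j + l j

fromNat : ∀ {g m r} → NatExtremeCycle g m r → ExtremeCycle g m r
fromNat {g} C = record
  { x        = λ j → + x j
  ; l        = λ j → + l j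
  ; digit    = λ j → Sum.map (cong (λ n → + n)) (cong (λ n → + n)) (digit j)
  ; distinct = λ e → distinct (ℤₚ.+-injective e)
  ; step     = λ j → trans (sym (ℤₚ.pos-* g (x (cyc j)))) (trans (cong (λ n → + n) (step j)) (ℤₚ.pos-+ (x j) (l j)))
  }
  where open NatExtremeCycle C

i≤g*i⇒0≤i : ∀ g i → 2 ≤ g → i ℤ.≤ + g ℤ.* i → + 0 ℤ.≤ i
i≤g*i⇒0≤i g         (+ n)    _                 _        = ℤ.+≤+ z≤n
i≤g*i⇒0≤i (suc (suc g)) -[1+ t ] (s≤s (s≤s z≤n)) (-≤- h) =
  ⊥-elim (ℕₚ.<-irrefl refl (ℕₚ.<-≤-trans (ℕₚ.m<m+n t {suc g * suc t} z<s) h))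

module _ {g m r} (C : ExtremeCycle g m r) where
  open ExtremeCycle C

  digit-nonneg : ∀ j → + 0 ℤ.≤ l j
  digit-nonneg j with digit j
  ... | inj₁ e rewrite e = ℤ.+≤+ z≤n
  ... | inj₂ e rewrite e = ℤ.+≤+ z≤n

  entries-nonneg : 2 ≤ g → ∀ j → + 0 ℤ.≤ x j
  entries-nonneg 2≤g j = ℤₚ.≤-trans (i≤g*i⇒0≤i g (x i) 2≤g x_i≤g*x_i) (x_i≤ j)
    where
    open ℤₚ.≤-Reasoning
    i = proj₁ (minimiser ℤₚ.≤-totalOrder x)
    x_i≤ = proj₂ (minimiser ℤₚ.≤-totalOrder x)
    k = cyc⁻¹ i
    x_i≤g*x_i : x i ℤ.≤ + g ℤ.* x i
    x_i≤g*x_i = begin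
      x i              ≡⟨ ℤₚ.+-identityʳ (x i) ⟨
      x i ℤ.+ + 0      ≤⟨ ℤₚ.+-mono-≤ (x_i≤ k) (digit-nonneg k) ⟩
      x k ℤ.+ l k      ≡⟨ step k ⟨
      + g ℤ.* x (cyc k) ≡⟨ cong (λ j → + g ℤ.* x j) (cyc-inverseʳ i) ⟩
      + g ℤ.* x i      ∎

  x≡+∣x∣ : 2 ≤ g → ∀ j → x j ≡ + ℤ.∣ x j ∣
  x≡+∣x∣ 2≤g j = sym (ℤₚ.0≤i⇒+∣i∣≡i (entries-nonneg 2≤g j))

  toNat : 2 ≤ g → NatExtremeCycle g m r
  toNat 2≤g = record
    { x        = λ j → ℤ.∣ x j ∣
    ; l        = λ j → ℤ.∣ l j ∣
    ; digit    = λ j → Sum.map (cong ℤ.∣_∣) (cong ℤ.∣_∣) (digit j)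
    ; distinct = λ e → distinct (trans (x≡+∣x∣ 2≤g _) (trans (cong (λ n → + n) e) (sym (x≡+∣x∣ 2≤g _))))
    ; step     = λ j → ℤₚ.+-injective (begin
        + (g * ℤ.∣ x (cyc j) ∣)        ≡⟨ ℤₚ.pos-* g _ ⟩
        + g ℤ.* + ℤ.∣ x (cyc j) ∣      ≡⟨ cong (+ g ℤ.*_) (x≡+∣x∣ 2≤g (cyc j)) ⟨
        + g ℤ.* x (cyc j)             ≡⟨ step j ⟩
        x j ℤ.+ l j                   ≡⟨ cong₂ ℤ._+_ (x≡+∣x∣ 2≤g j) (sym (ℤₚ.0≤i⇒+∣i∣≡i (digit-nonneg j))) ⟩
        + ℤ.∣ x j ∣ ℤ.+ + ℤ.∣ l j ∣    ≡⟨ ℤₚ.pos-+ ℤ.∣ x j ∣ ℤ.∣ l j ∣ ⟨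
        + (ℤ.∣ x j ∣ + ℤ.∣ l j ∣)      ∎)
    }
    where open ≡-Reasoning

digitBit : ∀ {m l} → l ≡ 0 ⊎ l ≡ m → Fin 2
digitBit (inj₁ _) = fzero
digitBit (inj₂ _) = fsuc fzero

digitBit-injective : ∀ {m l l′} (p : l ≡ 0 ⊎ l ≡ m) (q : l′ ≡ 0 ⊎ l′ ≡ m) → digitBit p ≡ digitBit q → l ≡ l′
digitBit-injective (inj₁ l≡0) (inj₁ l′≡0) _ = trans l≡0 (sym l′≡0)
digitBit-injective (inj₂ l≡m) (inj₂ l′≡m) _ = trans l≡m (sym l′≡m)

module NatExtremeCycleProperties {g m r : ℕ} (2≤g : 2 ≤ g) (C : NatExtremeCycle g m r) where
  open NatExtremeCycle C

  instance
    g≢0 : NonZero g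
    g≢0 = >-nonZero (ℕₚ.<-≤-trans z<s 2≤g)

  l≤m : ∀ j → l j ≤ m
  l≤m j = Sum.[ (λ e → subst (_≤ m) (sym e) z≤n) , ℕₚ.≤-reflexive ] (digit j)

  m∣l : ∀ j → m ∣ l j
  m∣l j = Sum.[ (λ e → subst (m ∣_) (sym e) (m ∣0)) , (λ e → subst (m ∣_) (sym e) ∣-refl) ] (digit j)

  entries-bounded : ∀ j → (g ∸ 1) * x j ≤ m
  entries-bounded j = ℕₚ.≤-trans (ℕₚ.*-monoʳ-≤ (g ∸ 1) (x≤x_i j)) (begin
    (g ∸ 1) * x i          ≡⟨ ℕₚ.*-distribʳ-∸ (x i) g 1 ⟩
    g * x i ∸ 1 * x i      ≡⟨ cong₂ _∸_ (cong (λ i → g * x i) (sym (cyc-inverseʳ i))) (ℕₚ.*-identityˡ (x i)) ⟩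
    g * x (cyc k) ∸ x i    ≡⟨ cong (_∸ x i) (step k) ⟩
    (x k + l k) ∸ x i      ≤⟨ ℕₚ.∸-monoˡ-≤ (x i) (ℕₚ.+-mono-≤ (x≤x_i k) (l≤m k)) ⟩
    (x i + m) ∸ x i        ≡⟨ ℕₚ.m+n∸m≡n (x i) m ⟩
    m                      ∎)
    where
    open ℕₚ.≤-Reasoning
    i = proj₁ (maximiser ℕₚ.≤-totalOrder x)
    x≤x_i = proj₂ (maximiser ℕₚ.≤-totalOrder x)
    k = cyc⁻¹ i

  zero-propagates : Coprime m g → ∀ j → x j ≡ 0 → x (cyc j) ≡ 0
  zero-propagates m⊥g j x≡0 with digit j
  ... | inj₁ l≡0 = ℕₚ.m*n≡0⇒m≡0 _ g (trans (ℕₚ.*-comm _ g) (trans (step j) (cong₂ _+_ x≡0 l≡0)))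
  ... | inj₂ l≡m = ⊥-elim (ℕₚ.<-irrefl (sym (m⊥g (g∣m , ∣-refl))) 2≤g)
    where
    g∣m : g ∣ m
    g∣m = divides (x (cyc j)) (trans (sym l≡m) (trans (cong (_+ l j) (sym x≡0)) (trans (sym (step j)) (ℕₚ.*-comm g _))))

  all-zero : Coprime m g → ∀ {k} → x k ≡ 0 → ∀ j → x j ≡ 0
  all-zero m⊥g = cyc-invariant (λ j → x j ≡ 0) (zero-propagates m⊥g)

  common-divisor : ∀ {d} → d ∣ m → Coprime d g → ∀ {k} → d ∣ x k → ∀ j → d ∣ x j
  common-divisor {d} d∣m d⊥g = cyc-invariant (λ j → d ∣ x j) preserved
    where
    preserved : ∀ j → d ∣ x j → d ∣ x (cyc j)
    preserved j d∣x = coprime-divisor d⊥g (subst (d ∣_) (sym (step j)) (∣m∣n⇒∣m+n d∣x (∣-trans d∣m (m∣l j))))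

  divide : ∀ d .{{_ : NonZero d}} → d ∣ m → (∀ j → d ∣ x j) → NatExtremeCycle g (m / d) r
  divide d d∣m d∣x = record
    { x        = λ j → x j / d
    ; l        = λ j → l j / d
    ; digit    = λ j → Sum.map (λ e → trans (cong (_/ d) e) (0/n≡0 d)) (cong (_/ d)) (digit j)
    ; distinct = λ {i} {j} e → distinct (begin
        x i          ≡⟨ m/n*n≡m (d∣x i) ⟨
        x i / d * d  ≡⟨ cong (_* d) e ⟩
        x j / d * d  ≡⟨ m/n*n≡m (d∣x j) ⟩
        x j          ∎)
    ; step     = λ j → begin
        g * (x (cyc j) / d)  ≡⟨ *-/-assoc g (d∣x (cyc j)) ⟨
        g * x (cyc j) / d    ≡⟨ cong (_/ d) (step j) ⟩
        (x j + l j) / d      ≡⟨ +-distrib-/-∣ˡ (l j) (d∣x j) ⟩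
        x j / d + l j / d    ∎
    }
    where open ≡-Reasoning

  digitValue : ℕ → Fin (suc r) → ℕ
  digitValue zero    j = 0
  digitValue (suc k) j = digitValue k j + g ^ k * l (cycⁿ k j)

  x+digitValue : ∀ k j → x j + digitValue k j ≡ g ^ k * x (cycⁿ k j)
  x+digitValue zero    j = trans (ℕₚ.+-identityʳ (x j)) (sym (ℕₚ.*-identityˡ (x j)))
  x+digitValue (suc k) j = begin
    x j + (digitValue k j + g ^ k * l c)   ≡⟨ ℕₚ.+-assoc (x j) _ _ ⟨
    x j + digitValue k j + g ^ k * l c     ≡⟨ cong (_+ g ^ k * l c) (x+digitValue k j) ⟩
    g ^ k * x c + g ^ k * l c              ≡⟨ ℕₚ.*-distribˡ-+ (g ^ k) (x c) (l c) ⟨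
    g ^ k * (x c + l c)                    ≡⟨ cong (g ^ k *_) (step c) ⟨
    g ^ k * (g * x (cyc c))                ≡⟨ *-x∙yz≈yx∙z (g ^ k) g (x (cyc c)) ⟩
    g * g ^ k * x (cyc c)                  ∎
    where
    open ≡-Reasoning
    c = cycⁿ k j

  m∣digitValue : ∀ k j → m ∣ digitValue k j
  m∣digitValue zero    j = m ∣0
  m∣digitValue (suc k) j = ∣m∣n⇒∣m+n (m∣digitValue k j) (∣n⇒∣m*n (g ^ k) (m∣l (cycⁿ k j)))

  coprime⇒m∣g^[1+r]∸1 : ∀ {j} → Coprime (x j) m → m ∣ g ^ suc r ∸ 1
  coprime⇒m∣g^[1+r]∸1 {j} x⊥m =
    coprime-divisor (coprime-sym x⊥m) (subst (m ∣_) (ℕₚ.*-comm (g ^ suc r ∸ 1) (x j)) m∣[G∸1]*x)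
    where
    open ≡-Reasoning
    [G∸1]*x≡digitValue : (g ^ suc r ∸ 1) * x j ≡ digitValue (suc r) j
    [G∸1]*x≡digitValue = begin
      (g ^ suc r ∸ 1) * x j                     ≡⟨ ℕₚ.*-distribʳ-∸ (x j) (g ^ suc r) 1 ⟩
      g ^ suc r * x j ∸ 1 * x j                 ≡⟨ cong₂ _∸_ (cong (λ i → g ^ suc r * x i) (sym (cyc-inverseʳ j))) (ℕₚ.*-identityˡ (x j)) ⟩
      g ^ suc r * x (cycⁿ (suc r) j) ∸ x j      ≡⟨ cong (_∸ x j) (x+digitValue (suc r) j) ⟨
      x j + digitValue (suc r) j ∸ x j          ≡⟨ ℕₚ.m+n∸m≡n (x j) _ ⟩
      digitValue (suc r) j                      ∎
    m∣[G∸1]*x : m ∣ (g ^ suc r ∸ 1) * x j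
    m∣[G∸1]*x = subst (m ∣_) (sym [G∸1]*x≡digitValue) (m∣digitValue (suc r) j)

  digitCode : (k : ℕ) → Fin (suc r) → Fin (2 ^ k)
  digitCode zero    j = fzero
  digitCode (suc k) j = combine (digitBit (digit (cycⁿ k j))) (digitCode k j)

  digitCode-determines-digitValue : ∀ k {i j} → digitCode k i ≡ digitCode k j → digitValue k i ≡ digitValue k j
  digitCode-determines-digitValue zero    _ = refl
  digitCode-determines-digitValue (suc k) {i} {j} e
    with combine-injective (digitBit (digit (cycⁿ k i))) (digitCode k i) (digitBit (digit (cycⁿ k j))) (digitCode k j) e
  ... | bits , codes = cong₂ (λ v l → v + g ^ k * l)
    (digitCode-determines-digitValue k codes) (digitBit-injective (digit (cycⁿ k i)) (digit (cycⁿ k j)) bits)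

  -- x_j is determined by its next n digits, which fix x_j modulo g^n, and by the quotient
  -- ⌊(x_j - 1)/g^n⌋; the shift by one is what keeps that quotient below ⌈m/((g-1)g^n)⌉.
  length≤bound : (∀ j → x j ≢ 0) → ∀ n → suc r ≤ bound g m n
  length≤bound x≢0 n = injective⇒≤ {f = encode} encode-injective
    where
    G H : ℕ
    G = g ^ n
    H = (g ∸ 1) * G
    instance
      G≢0 : NonZero G
      G≢0 = ℕₚ.m^n≢0 g n
      g∸1≢0 : NonZero (g ∸ 1)
      g∸1≢0 = >-nonZero (ℕₚ.∸-monoˡ-< 2≤g (s≤s z≤n))
      H≢0 : NonZero H
      H≢0 = ℕₚ.m*n≢0 (g ∸ 1) G

    suc-pred[x] : ∀ j → suc (pred (x j)) ≡ x j
    suc-pred[x] j = ℕₚ.suc-pred (x j) {{≢-nonZero (x≢0 j)}}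

    pred[x]<x : ∀ j → pred (x j) < x j
    pred[x]<x j = ℕₚ.≤-reflexive (suc-pred[x] j)

    quotient : Fin (suc r) → ℕ
    quotient j = pred (x j) / G

    quotient*H<m : ∀ j → quotient j * H < m
    quotient*H<m j = begin-strict
      quotient j * ((g ∸ 1) * G)   ≡⟨ *-x∙yz≈y∙xz (quotient j) (g ∸ 1) G ⟩
      (g ∸ 1) * (quotient j * G)   <⟨ ℕₚ.*-monoʳ-< (g ∸ 1) (ℕₚ.≤-<-trans (m/n*n≤m (pred (x j)) G) (pred[x]<x j)) ⟩
      (g ∸ 1) * x j                ≤⟨ entries-bounded j ⟩
      m                            ∎
      where open ℕₚ.≤-Reasoning

    quotient<ceil : ∀ j → quotient j < ceilDiv m H
    quotient<ceil j = <-ceilDiv (quotient j) m H (>-nonZero⁻¹ H) (quotient*H<m j)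

    G∣pred[x]+suc[digitValue] : ∀ j → G ∣ pred (x j) + suc (digitValue n j)
    G∣pred[x]+suc[digitValue] j = divides (x (cycⁿ n j)) (begin
      pred (x j) + suc (digitValue n j)  ≡⟨ ℕₚ.+-suc (pred (x j)) _ ⟩
      suc (pred (x j)) + digitValue n j  ≡⟨ cong (_+ digitValue n j) (suc-pred[x] j) ⟩
      x j + digitValue n j               ≡⟨ x+digitValue n j ⟩
      G * x (cycⁿ n j)                   ≡⟨ ℕₚ.*-comm G _ ⟩
      x (cycⁿ n j) * G                   ∎)
      where open ≡-Reasoning

    encode : Fin (suc r) → Fin (bound g m n)
    encode j = combine (digitCode n j) (fromℕ< (quotient<ceil j))

    encode-injective : Injective _≡_ _≡_ encode
    encode-injective {i} {j} e = distinct (begin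
      x i               ≡⟨ suc-pred[x] i ⟨
      suc (pred (x i))  ≡⟨ cong suc pred[x]-equal ⟩
      suc (pred (x j))  ≡⟨ suc-pred[x] j ⟩
      x j               ∎)
      where
      open ≡-Reasoning
      qᵢ = fromℕ< (quotient<ceil i)
      qⱼ = fromℕ< (quotient<ceil j)
      codes : digitCode n i ≡ digitCode n j
      codes = proj₁ (combine-injective (digitCode n i) qᵢ (digitCode n j) qⱼ e)
      quotients : qᵢ ≡ qⱼ
      quotients = proj₂ (combine-injective (digitCode n i) qᵢ (digitCode n j) qⱼ e)
      pred[x]-equal : pred (x i) ≡ pred (x j)
      pred[x]-equal = ≡-by-quotient G (G∣pred[x]+suc[digitValue] i)
        (subst (λ D → G ∣ pred (x j) + suc D) (sym (digitCode-determines-digitValue n codes)) (G∣pred[x]+suc[digitValue] j))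
        (trans (sym (toℕ-fromℕ< (quotient<ceil i))) (trans (cong toℕ quotients) (toℕ-fromℕ< (quotient<ceil j))))

  gcd≢1⇒x₀≡0 : 1 ≤ m → Coprime m g → gcd (x fzero) m ≢ 1 →
                          (∀ d → d ∣ m → d ≢ m → Complete g d) → x fzero ≡ 0
  gcd≢1⇒x₀≡0 1≤m m⊥g d≢1 divisors-complete = begin
    x fzero           ≡⟨ m/n*n≡m d∣x₀ ⟨
    x fzero / d * d   ≡⟨ cong (_* d) (ℤₚ.+-injective x₀/d≡0) ⟩
    0                 ∎
    where
    open ≡-Reasoning
    d = gcd (x fzero) m
    d∣m = gcd[m,n]∣n (x fzero) m
    d∣x₀ = gcd[m,n]∣m (x fzero) m
    instance
      m≢0 : NonZero m
      m≢0 = >-nonZero 1≤m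
      d≢0 : NonZero d
      d≢0 = ≢-nonZero (gcd[m,n]≢0 (x fzero) m (inj₂ (≢-nonZero⁻¹ m)))
    m/d≢m : m / d ≢ m
    m/d≢m m/d≡m = d≢1 (sym (ℕₚ.*-cancelˡ-≡ 1 d m (begin
      m * 1      ≡⟨ ℕₚ.*-identityʳ m ⟩
      m          ≡⟨ m/n*n≡m d∣m ⟨
      m / d * d  ≡⟨ cong (_* d) m/d≡m ⟩
      m * d      ∎)))
    d⊥g : Coprime d g
    d⊥g (i∣d , i∣g) = m⊥g (∣-trans i∣d d∣m , i∣g)
    x₀/d≡0 : + (x fzero / d) ≡ + 0
    x₀/d≡0 = divisors-complete (m / d) (m/n∣m d∣m) m/d≢m r
      (fromNat (divide d d∣m (common-divisor d∣m d⊥g d∣x₀))) fzero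

  coprime⇒order≤length : ∀ {o j} → IsOrder g m o → Coprime (x j) m → o ≤ suc r
  coprime⇒order≤length (_ , _ , minimal) x⊥m = minimal (suc r) (s≤s z≤n) (coprime⇒m∣g^[1+r]∸1 x⊥m)

  trivial : ∀ {o} n → 1 ≤ m → Coprime m g → IsOrder g m o → bound g m n < o →
            (∀ d → d ∣ m → d ≢ m → Complete g d) → ∀ j → x j ≡ 0
  trivial n 1≤m m⊥g order bound<o divisors = all-zero m⊥g (decidable-stable (x fzero ℕₚ.≟ 0) x₀≢0-absurd)
    where
    x₀≢0-absurd : x fzero ≢ 0 → ⊥
    x₀≢0-absurd x₀≢0 with gcd (x fzero) m ℕₚ.≟ 1
    ... | yes gcd≡1 = ℕₚ.<-irrefl refl (ℕₚ.<-≤-trans bound<o (ℕₚ.≤-trans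
          (coprime⇒order≤length order (gcd≡1⇒coprime gcd≡1)) (length≤bound x≢0 n)))
      where
      x≢0 : ∀ j → x j ≢ 0
      x≢0 j xj≡0 = x₀≢0 (all-zero m⊥g xj≡0 fzero)
    ... | no gcd≢1 = x₀≢0 (gcd≢1⇒x₀≡0 1≤m m⊥g gcd≢1 divisors)

theorem2p30 : (g m : ℕ) → 4 ≤ g → g % 2 ≡ 0 → 1 ≤ m → m % 2 ≡ 1 → Coprime m g →
    (o : ℕ) → IsOrder g m o →
    (∃ λ n → bound g m n < o) →
    ((∀ d → d ∣ m → d ≢ m → Complete g d) → Complete g m) × ¬ Primitive g m
theorem2p30 g m 4≤g _ 1≤m _ m⊥g o order (n , bound<o) = complete , not-primitive
  where
  2≤g : 2 ≤ g
  2≤g = ℕₚ.≤-trans (s≤s (s≤s z≤n)) 4≤g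

  complete : (∀ d → d ∣ m → d ≢ m → Complete g d) → Complete g m
  complete divisors r C j = trans (x≡+∣x∣ C 2≤g j) (cong (λ k → + k)
    (NatExtremeCycleProperties.trivial 2≤g (toNat C 2≤g) n 1≤m m⊥g order bound<o divisors j))

  not-primitive : ¬ Primitive g m
  not-primitive (incomplete , divisors) = incomplete (complete divisors)
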